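{- For every integer $a\ge 8$, $$ s(a,a+4,a+5,a+6)=\begin{cases} \frac{a^4+21 a^3+261 a^2+1494 a+2808}{216}&\text{if } a\equiv 0\pmod 6,\\ \frac{a^4+21 a^3+222 a^2+1199 a+2445}{216}&\text{if } a\equiv 1\pmod 6,\\ \frac{a^4+21 a^3+213 a^2+1078 a+1992}{216}&\text{if } a\equiv 2\pmod 6,\\ \frac{(a+3)(a^3+18 a^2+144 a+495)}{216}&\text{if } a\equiv 3\pmod 6,\\ \frac{a^4+21 a^3+213 a^2+1046 a+1608}{216}&\text{if } a\equiv 4\pmod 6,\\ \frac{a^4+21 a^3+222 a^2+1087 a+1533}{216}&\text{if } a\equiv 5\pmod 6. \end{cases} $$
   Context: For positive integers $a_1,\dots,a_m$ with $\gcd(a_1,\dots,a_m)=1$, the Sylvester sum $s(a_1,\dots,a_m)$ is the sum of all positive integers that cannot be written as $x_1a_1+\cdots+x_ma_m$ with nonnegative integers $x_i$. -}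

module Defs where

open import Data.Nat using (ℕ; _<_; _*_)
open import Data.Vec using (Vec; zipWith)
open import Data.Vec using () renaming (sum to vsum)
open import Data.List using (List)
open import Data.Nat.ListAction using (sum)
open import Data.List.Membership.Propositional using (_∈_)
open import Data.List.Relation.Unary.Unique.Propositional using (Unique)
open import Data.Product using (Σ; ∃; _×_)
open import Function.Bundles using (_⇔_)
open import Relation.Nullary using (¬_)
open import Relation.Binary.PropositionalEquality using (_≡_)

Representable : ∀ {m} → Vec ℕ m → ℕ → Set
Representable {m} as n = ∃ λ (xs : Vec ℕ m) → vsum (zipWith _*_ xs as) ≡ n

Gap : ∀ {m} → Vec ℕ m → ℕ → Set
Gap as n = (0 < n) × ¬ Representable as n

IsSylvesterSum : ∀ {m} → Vec ℕ m → ℕ → Set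
IsSylvesterSum as s =
  Σ (List ℕ) λ L → Unique L × (∀ n → (n ∈ L) ⇔ Gap as n) × sum L ≡ s

-- A number k a + r (r < a) is representable iff it is K a + t with t a sum of at
-- most K terms from {4, 5, 6}. Such t are exactly the non-gaps of ⟨4, 5, 6⟩, that
-- is 0, 4, 5, 6 and every t ≥ 8, and ⌈t/6⌉ terms suffice. So the gaps in the class
-- of r are the k a + r with k below κ(r) = ⌈r/6⌉, except for the gaps r = 1, 2, 3, 7
-- of ⟨4, 5, 6⟩, which must borrow one copy of a: κ(r) = 1 + ⌈(a + r)/6⌉. The
-- Sylvester sum is then Σ_{r<a} Σ_{k<κ(r)} (k a + r); the residues 7 + 6m, …,
-- 7 + 6m + 5 share ⌈r/6⌉ = m + 2, so for each residue of a modulo 6 the sum is a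
-- polynomial in a.

module Submission where

open import Defs
open import Data.Nat using (ℕ; zero; suc; _+_; _*_; _^_; _≤_; _<_; _≰_; _%_; _/_; NonZero; z≤n; s≤s; s≤s⁻¹)
open import Data.Nat.Properties
open import Data.Nat.DivMod
open import Data.Nat.Divisibility using (divides-refl)
open import Data.Nat.ListAction using (sum)
open import Data.Nat.ListAction.Properties using (sum-++)
open import Data.Nat.Tactic.RingSolver using (solve-∀)
open import Data.Vec using (Vec; _∷_; [])
open import Data.List using (List; []; _∷_; _∷ʳ_; applyUpTo; concat; map)
open import Data.List.Properties using (applyUpTo-∷ʳ; map-applyUpTo)
open import Data.List.Membership.Propositional using (_∈_)
open import Data.List.Membership.Propositional.Properties
  using (∈-concat⁺′; ∈-concat⁻′; ∈-applyUpTo⁺; ∈-applyUpTo⁻)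
open import Data.List.Relation.Binary.Disjoint.Propositional using (Disjoint)
open import Data.List.Relation.Unary.All.Properties using (applyUpTo⁺₂)
open import Data.List.Relation.Unary.Unique.Propositional using (Unique)
import Data.List.Relation.Unary.Unique.Propositional.Properties as Unique
import Data.List.Relation.Unary.AllPairs.Properties as AllPairs
open import Data.Product using (∃; ∃₂; ∃-syntax; _×_; _,_; proj₁; proj₂)
open import Function.Bundles using (_⇔_; mk⇔; Equivalence)
open import Relation.Nullary using (¬_; yes; no; contradiction)
open import Relation.Unary using (Decidable)
open import Relation.Binary.PropositionalEquality

∑ : ℕ → (ℕ → ℕ) → ℕ
∑ n f = sum (applyUpTo f n)

∑-suc : ∀ n f → ∑ (suc n) f ≡ ∑ n f + f n
∑-suc n f = begin
  sum (applyUpTo f (suc n))   ≡⟨ cong sum (applyUpTo-∷ʳ f n) ⟨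
  sum (applyUpTo f n ∷ʳ f n)  ≡⟨ sum-++ (applyUpTo f n) _ ⟩
  ∑ n f + (f n + 0)           ≡⟨ cong (∑ n f +_) (+-identityʳ (f n)) ⟩
  ∑ n f + f n                 ∎
  where open ≡-Reasoning

∑-+ : ∀ m n f → ∑ (m + n) f ≡ ∑ m f + ∑ n (λ i → f (m + i))
∑-+ m zero f = trans (cong (λ k → ∑ k f) (+-identityʳ m)) (sym (+-identityʳ (∑ m f)))
∑-+ m (suc n) f = begin
  ∑ (m + suc n) f                               ≡⟨ cong (λ k → ∑ k f) (+-suc m n) ⟩
  ∑ (suc (m + n)) f                             ≡⟨ ∑-suc (m + n) f ⟩
  ∑ (m + n) f + f (m + n)                       ≡⟨ cong (_+ f (m + n)) (∑-+ m n f) ⟩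
  ∑ m f + ∑ n (λ i → f (m + i)) + f (m + n)     ≡⟨ +-assoc (∑ m f) _ _ ⟩
  ∑ m f + (∑ n (λ i → f (m + i)) + f (m + n))   ≡⟨ cong (∑ m f +_) (∑-suc n (λ i → f (m + i))) ⟨
  ∑ m f + ∑ (suc n) (λ i → f (m + i))           ∎
  where open ≡-Reasoning

sum-concat : ∀ (xss : List (List ℕ)) → sum (concat xss) ≡ sum (map sum xss)
sum-concat []         = refl
sum-concat (xs ∷ xss) = trans (sum-++ xs (concat xss)) (cong (sum xs +_) (sum-concat xss))

zero-representable : ∀ {n} (as : Vec ℕ n) → Representable as 0
zero-representable []       = [] , refl
zero-representable (_ ∷ as) with xs , eq ← zero-representable as = 0 ∷ xs , eq

module _ {a : ℕ} .{{_ : NonZero a}} (k t : ℕ) where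

  [k*a+t]/a≡k+t/a : (k * a + t) / a ≡ k + t / a
  [k*a+t]/a≡k+t/a = trans (+-distrib-/-∣ˡ t (divides-refl k)) (cong (_+ t / a) (m*n/n≡m k a))

  [k*a+t]%a≡t%a : (k * a + t) % a ≡ t % a
  [k*a+t]%a≡t%a = trans (cong (_% a) (+-comm (k * a) t)) ([m+kn]%n≡m%n t k a)

-- Gaps of a numerical semigroup through its Apéry set with respect to a generator a:
-- κ r · a + r is the least representable element of the class of r.
module ApéryQuotients {n} (as : Vec ℕ n) (a : ℕ) .{{_ : NonZero a}} (κ : ℕ → ℕ)
  (representable⇔ : ∀ k r → r < a → Representable as (k * a + r) ⇔ κ r ≤ k) where

  classGaps : ℕ → List ℕ
  classGaps r = applyUpTo (λ k → k * a + r) (κ r)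

  gaps : List ℕ
  gaps = concat (applyUpTo classGaps a)

  ∈-classGaps⁻ : ∀ {y r} → y ∈ classGaps r → ∃ λ k → k < κ r × y ≡ k * a + r
  ∈-classGaps⁻ = ∈-applyUpTo⁻ _

  ∈-gaps⁻ : ∀ {y} → y ∈ gaps → ∃₂ λ k r → r < a × k < κ r × y ≡ k * a + r
  ∈-gaps⁻ y∈gaps =
    let xs , y∈xs , xs∈ = ∈-concat⁻′ (applyUpTo classGaps a) y∈gaps
        r , r<a , xs≡ = ∈-applyUpTo⁻ classGaps xs∈
        k , k<κ , y≡ = ∈-classGaps⁻ (subst (_ ∈_) xs≡ y∈xs)
    in k , r , r<a , k<κ , y≡

  ∈-gaps⁺ : ∀ {k r} → r < a → k < κ r → k * a + r ∈ gaps
  ∈-gaps⁺ r<a k<κ = ∈-concat⁺′ (∈-applyUpTo⁺ _ k<κ) (∈-applyUpTo⁺ classGaps r<a)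

  ∈-gaps⇔Gap : ∀ y → y ∈ gaps ⇔ Gap as y
  ∈-gaps⇔Gap y = mk⇔ to from
    where
    to : y ∈ gaps → Gap as y
    to y∈gaps with k , r , r<a , k<κ , refl ← ∈-gaps⁻ y∈gaps =
      n≢0⇒n>0 (λ y≡0 → ¬rep (subst (Representable as) (sym y≡0) (zero-representable as))) , ¬rep
      where
      ¬rep : ¬ Representable as (k * a + r)
      ¬rep rep = <⇒≱ k<κ (Equivalence.to (representable⇔ k r r<a) rep)

    from : Gap as y → y ∈ gaps
    from (_ , ¬rep) = subst (_∈ gaps) (sym y≡) (∈-gaps⁺ (m%n<n y a) (≰⇒> κ≰))
      where
      y≡ : y ≡ y / a * a + y % a
      y≡ = trans (m≡m%n+[m/n]*n y a) (+-comm (y % a) _)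
      κ≰ : κ (y % a) ≰ y / a
      κ≰ κ≤ = ¬rep (subst (Representable as) (sym y≡)
                     (Equivalence.from (representable⇔ (y / a) (y % a) (m%n<n y a)) κ≤))

  gaps-unique : Unique gaps
  gaps-unique = Unique.concat⁺ (applyUpTo⁺₂ classGaps a classGaps-unique)
                               (AllPairs.applyUpTo⁺₁ classGaps a classGaps-disjoint)
    where
    classGaps-unique : ∀ r → Unique (classGaps r)
    classGaps-unique r = Unique.applyUpTo⁺₁ _ (κ r) λ i<j _ eq →
      <⇒≢ i<j (*-cancelʳ-≡ _ _ a (+-cancelʳ-≡ r _ _ eq))

    classGaps-disjoint : ∀ {r r′} → r < r′ → r′ < a → Disjoint (classGaps r) (classGaps r′)
    classGaps-disjoint {r} {r′} r<r′ r′<a (y∈r , y∈r′)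
      with k , _ , refl ← ∈-classGaps⁻ y∈r | k′ , _ , y≡ ← ∈-classGaps⁻ y∈r′ =
      <⇒≢ r<r′ (begin
        r                  ≡⟨ m<n⇒m%n≡m (<-trans r<r′ r′<a) ⟨
        r % a              ≡⟨ [k*a+t]%a≡t%a k r ⟨
        (k * a + r) % a    ≡⟨ cong (_% a) y≡ ⟩
        (k′ * a + r′) % a  ≡⟨ [k*a+t]%a≡t%a k′ r′ ⟩
        r′ % a             ≡⟨ m<n⇒m%n≡m r′<a ⟩
        r′                 ∎)
      where open ≡-Reasoning

  isSylvesterSum : IsSylvesterSum as (∑ a λ r → ∑ (κ r) λ k → k * a + r)
  isSylvesterSum = gaps , gaps-unique , ∈-gaps⇔Gap
                 , trans (sum-concat (applyUpTo classGaps a)) (cong sum (map-applyUpTo classGaps sum a))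

-- The numerical semigroup ⟨4, 5, 6⟩

⌈_/6⌉ : ℕ → ℕ
⌈ t /6⌉ = (t + 5) / 6

≤⌈/6⌉*6 : ∀ t → t ≤ ⌈ t /6⌉ * 6
≤⌈/6⌉*6 t = +-cancelʳ-≤ 5 t (⌈ t /6⌉ * 6) (begin
  t + 5                          ≡⟨ m≡m%n+[m/n]*n (t + 5) 6 ⟩
  (t + 5) % 6 + ⌈ t /6⌉ * 6      ≤⟨ +-monoˡ-≤ _ (s≤s⁻¹ (m%n<n (t + 5) 6)) ⟩
  5 + ⌈ t /6⌉ * 6                ≡⟨ +-comm 5 _ ⟩
  ⌈ t /6⌉ * 6 + 5                ∎)
  where open ≤-Reasoning

⌈/6⌉-least : ∀ {t k} → t ≤ k * 6 → ⌈ t /6⌉ ≤ k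
⌈/6⌉-least {t} {k} t≤ = s≤s⁻¹ (m<n*o⇒m/o<n (begin-strict
  t + 5       ≤⟨ +-monoˡ-≤ 5 t≤ ⟩
  k * 6 + 5   <⟨ +-monoʳ-< (k * 6) (n<1+n 5) ⟩
  k * 6 + 6   ≡⟨ +-comm (k * 6) 6 ⟩
  suc k * 6   ∎))
  where open ≤-Reasoning

⌈/6⌉-mono : ∀ {s t} → s ≤ t → ⌈ s /6⌉ ≤ ⌈ t /6⌉
⌈/6⌉-mono s≤t = /-monoˡ-≤ 6 (+-monoˡ-≤ 5 s≤t)

⌈+*6/6⌉ : ∀ t k → ⌈ t + k * 6 /6⌉ ≡ ⌈ t /6⌉ + k
⌈+*6/6⌉ t k = begin
  (t + k * 6 + 5) / 6       ≡⟨ cong (_/ 6) (swap t (k * 6)) ⟩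
  (t + 5 + k * 6) / 6       ≡⟨ +-distrib-/-∣ʳ (t + 5) (divides-refl k) ⟩
  ⌈ t /6⌉ + k * 6 / 6       ≡⟨ cong (⌈ t /6⌉ +_) (m*n/n≡m k 6) ⟩
  ⌈ t /6⌉ + k               ∎
  where
  open ≡-Reasoning
  swap : ∀ x y → x + y + 5 ≡ x + 5 + y
  swap = solve-∀

data Gap456 : ℕ → Set where
  gap1 : Gap456 1
  gap2 : Gap456 2
  gap3 : Gap456 3
  gap7 : Gap456 7

gap456? : Decidable Gap456
gap456? 0 = no λ ()
gap456? 1 = yes gap1
gap456? 2 = yes gap2
gap456? 3 = yes gap3
gap456? 4 = no λ ()
gap456? 5 = no λ ()
gap456? 6 = no λ ()
gap456? 7 = yes gap7
gap456? (suc (suc (suc (suc (suc (suc (suc (suc _)))))))) = no λ ()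

Gap456⇒<8 : ∀ {t} → Gap456 t → t < 8
Gap456⇒<8 gap1 = m≤m+n 2 6
Gap456⇒<8 gap2 = m≤m+n 3 5
Gap456⇒<8 gap3 = m≤m+n 4 4
Gap456⇒<8 gap7 = ≤-refl

Gap456⇒>0 : ∀ {t} → Gap456 t → 0 < t
Gap456⇒>0 gap1 = s≤s z≤n
Gap456⇒>0 gap2 = s≤s z≤n
Gap456⇒>0 gap3 = s≤s z≤n
Gap456⇒>0 gap7 = s≤s z≤n

between⇒¬Gap456 : ∀ {j t} → j * 4 ≤ t → t ≤ j * 6 → ¬ Gap456 t
between⇒¬Gap456 {0}           _                    z≤n ()
between⇒¬Gap456 {1}           (s≤s ())             _   gap1
between⇒¬Gap456 {1}           (s≤s (s≤s ()))       _   gap2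
between⇒¬Gap456 {1}           (s≤s (s≤s (s≤s ()))) _   gap3
between⇒¬Gap456 {1}           _                    7≤6 gap7 = 1+n≰n 7≤6
between⇒¬Gap456 {suc (suc j)} lo                   _   g    =
  <⇒≱ (Gap456⇒<8 g) (≤-trans (m≤m+n 8 (j * 4)) lo)

¬Gap456⇒⌈/6⌉*4≤ : ∀ t → ¬ Gap456 t → ⌈ t /6⌉ * 4 ≤ t
¬Gap456⇒⌈/6⌉*4≤ 0 _ = z≤n
¬Gap456⇒⌈/6⌉*4≤ 1 ¬g = contradiction gap1 ¬g
¬Gap456⇒⌈/6⌉*4≤ 2 ¬g = contradiction gap2 ¬g
¬Gap456⇒⌈/6⌉*4≤ 3 ¬g = contradiction gap3 ¬g
¬Gap456⇒⌈/6⌉*4≤ 4 _ = ≤-refl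
¬Gap456⇒⌈/6⌉*4≤ 5 _ = n≤1+n 4
¬Gap456⇒⌈/6⌉*4≤ 6 _ = m≤m+n 4 2
¬Gap456⇒⌈/6⌉*4≤ 7 ¬g = contradiction gap7 ¬g
¬Gap456⇒⌈/6⌉*4≤ 8 _ = ≤-refl
¬Gap456⇒⌈/6⌉*4≤ 9 _ = n≤1+n 8
¬Gap456⇒⌈/6⌉*4≤ t@(suc (suc (suc (suc (suc (suc (suc (suc (suc (suc u)))))))))) _ =
  *-cancelˡ-≤ 3 (begin
    3 * (⌈ t /6⌉ * 4)     ≡⟨ twelve ⌈ t /6⌉ ⟩
    2 * (⌈ t /6⌉ * 6)     ≤⟨ *-monoʳ-≤ 2 (m/n*n≤m (t + 5) 6) ⟩
    2 * (t + 5)           ≤⟨ m≤m+n (2 * (t + 5)) u ⟩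
    2 * (t + 5) + u       ≡⟨ ten≤ u ⟩
    3 * t                 ∎)
  where
  open ≤-Reasoning
  twelve : ∀ x → 3 * (x * 4) ≡ 2 * (x * 6)
  twelve = solve-∀
  ten≤ : ∀ u → 2 * (10 + u + 5) + u ≡ 3 * (10 + u)
  ten≤ = solve-∀

ConsecutiveSum : ℕ → ℕ → ℕ → Set
ConsecutiveSum d j t =
  ∃[ x ] ∃[ y ] ∃[ z ] (x + y + z ≡ j × x * d + y * (1 + d) + z * (2 + d) ≡ t)

consecutiveSum-suc : ∀ {d j t} i → i ≤ 2 → ConsecutiveSum d j t →
                     ConsecutiveSum d (suc j) (i + d + t)
consecutiveSum-suc {d} 0 _ (x , y , z , refl , refl) =
  suc x , y , z , refl , add-x x y z d
  where
  add-x : ∀ x y z d → suc x * d + y * (1 + d) + z * (2 + d) ≡ d + (x * d + y * (1 + d) + z * (2 + d))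
  add-x = solve-∀
consecutiveSum-suc {d} 1 _ (x , y , z , refl , refl) =
  x , suc y , z , count x y z , add-y x y z d
  where
  count : ∀ x y z → x + suc y + z ≡ suc (x + y + z)
  count = solve-∀
  add-y : ∀ x y z d → x * d + suc y * (1 + d) + z * (2 + d) ≡ 1 + d + (x * d + y * (1 + d) + z * (2 + d))
  add-y = solve-∀
consecutiveSum-suc {d} 2 _ (x , y , z , refl , refl) =
  x , y , suc z , count x y z , add-z x y z d
  where
  count : ∀ x y z → x + y + suc z ≡ suc (x + y + z)
  count = solve-∀
  add-z : ∀ x y z d → x * d + y * (1 + d) + suc z * (2 + d) ≡ 2 + d + (x * d + y * (1 + d) + z * (2 + d))
  add-z = solve-∀
consecutiveSum-suc (suc (suc (suc _))) (s≤s (s≤s ())) _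

add-term : ∀ i d j e → i + d + (j * d + e) ≡ suc j * d + (i + e)
add-term = solve-∀

consecutiveSum-interval : ∀ d j e → e ≤ j * 2 → ConsecutiveSum d j (j * d + e)
consecutiveSum-interval d zero    zero          _ = 0 , 0 , 0 , refl , refl
consecutiveSum-interval d (suc j) zero          _ =
  subst (ConsecutiveSum d (suc j)) (add-term 0 d j 0)
    (consecutiveSum-suc 0 z≤n (consecutiveSum-interval d j 0 z≤n))
consecutiveSum-interval d (suc j) (suc zero)    _ =
  subst (ConsecutiveSum d (suc j)) (add-term 1 d j 0)
    (consecutiveSum-suc 1 (s≤s z≤n) (consecutiveSum-interval d j 0 z≤n))
consecutiveSum-interval d (suc j) (suc (suc e)) (s≤s (s≤s e≤)) =
  subst (ConsecutiveSum d (suc j)) (add-term 2 d j e)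
    (consecutiveSum-suc 2 ≤-refl (consecutiveSum-interval d j e e≤))

consecutiveSum-bounds : ∀ {d j t} → ConsecutiveSum d j t → j * d ≤ t × t ≤ j * (2 + d)
consecutiveSum-bounds {d} (x , y , z , refl , refl) =
  subst (_≤ x * d + y * (1 + d) + z * (2 + d)) (distrib x y z d)
    (+-mono-≤ (+-monoʳ-≤ (x * d) (*-monoʳ-≤ y (n≤1+n d))) (*-monoʳ-≤ z (m≤n+m d 2))) ,
  subst (x * d + y * (1 + d) + z * (2 + d) ≤_) (distrib x y z (2 + d))
    (+-mono-≤ (+-mono-≤ (*-monoʳ-≤ x (m≤n+m d 2)) (*-monoʳ-≤ y (n≤1+n (1 + d)))) ≤-refl)
  where
  distrib : ∀ x y z d → x * d + y * d + z * d ≡ (x + y + z) * d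
  distrib = solve-∀

consecutiveSum456-⌈/6⌉ : ∀ {t} → ¬ Gap456 t → ConsecutiveSum 4 ⌈ t /6⌉ t
consecutiveSum456-⌈/6⌉ {t} ¬g with e , eq ← m≤n⇒∃[o]m+o≡n (¬Gap456⇒⌈/6⌉*4≤ t ¬g) =
  subst (ConsecutiveSum 4 ⌈ t /6⌉) eq (consecutiveSum-interval 4 ⌈ t /6⌉ e e≤)
  where
  six : ∀ j → j * 6 ≡ j * 4 + j * 2
  six = solve-∀
  e≤ : e ≤ ⌈ t /6⌉ * 2
  e≤ = +-cancelˡ-≤ (⌈ t /6⌉ * 4) e _
         (subst₂ _≤_ (sym eq) (six ⌈ t /6⌉) (≤⌈/6⌉*6 t))

consecutiveSum456⇒ : ∀ {j t} → ConsecutiveSum 4 j t → ¬ Gap456 t × ⌈ t /6⌉ ≤ j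
consecutiveSum456⇒ {j} cs with lo , hi ← consecutiveSum-bounds cs =
  between⇒¬Gap456 {j} lo hi , ⌈/6⌉-least hi

-- Representability by a, a + 4, a + 5, a + 6

gens : ℕ → Vec ℕ 4
gens a = a ∷ a + 4 ∷ a + 5 ∷ a + 6 ∷ []

representable⁺ : ∀ a {K j t} → j ≤ K → ConsecutiveSum 4 j t → Representable (gens a) (K * a + t)
representable⁺ a j≤K (x , y , z , refl , refl) with x₀ , refl ← m≤n⇒∃[o]m+o≡n j≤K =
  (x₀ ∷ x ∷ y ∷ z ∷ []) , combine x₀ x y z a
  where
  combine : ∀ x₀ x y z a → x₀ * a + (x * (a + 4) + (y * (a + 5) + (z * (a + 6) + 0)))
                         ≡ (x + y + z + x₀) * a + (x * 4 + y * (1 + 4) + z * (2 + 4))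
  combine = solve-∀

representable⁻ : ∀ a {n} → Representable (gens a) n →
                 ∃[ K ] ∃[ j ] ∃[ t ] (n ≡ K * a + t × j ≤ K × ConsecutiveSum 4 j t)
representable⁻ a ((x₀ ∷ x ∷ y ∷ z ∷ []) , refl) =
  x₀ + (x + y + z) , x + y + z , x * 4 + y * 5 + z * 6 ,
  split x₀ x y z a , m≤n+m (x + y + z) x₀ , (x , y , z , refl , refl)
  where
  split : ∀ x₀ x y z a → x₀ * a + (x * (a + 4) + (y * (a + 5) + (z * (a + 6) + 0)))
                       ≡ (x₀ + (x + y + z)) * a + (x * 4 + y * 5 + z * 6)
  split = solve-∀

-- For a gap r of ⟨4, 5, 6⟩ one copy of a is spent, and a + r needs ⌈(a + r)/6⌉ terms.
apéry : ℕ → ℕ → ℕ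
apéry a r with gap456? r
... | yes _ = suc ⌈ a + r /6⌉
... | no  _ = ⌈ r /6⌉

apéry≤ : ∀ a r → apéry a r ≤ suc ⌈ a + r /6⌉
apéry≤ a r with gap456? r
... | yes _ = ≤-refl
... | no  _ = m≤n⇒m≤1+n (⌈/6⌉-mono (m≤n+m r a))

apéry-least : ∀ {a r K t} → ¬ Gap456 t → t ≤ K * 6 → ∀ q → t ≡ r + q * a → apéry a r ≤ K + q
apéry-least {r = r} {K} ¬g t≤ zero t≡ with gap456? r | trans t≡ (+-identityʳ r)
... | yes g | refl = contradiction g ¬g
... | no  _ | refl = ≤-trans (⌈/6⌉-least t≤) (≤-reflexive (sym (+-identityʳ K)))
apéry-least {a} {r} {K} {t} ¬g t≤ (suc q) t≡ = begin
  apéry a r           ≤⟨ apéry≤ a r ⟩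
  suc ⌈ a + r /6⌉     ≤⟨ s≤s (⌈/6⌉-least (≤-trans a+r≤t t≤)) ⟩
  suc K               ≤⟨ s≤s (m≤m+n K q) ⟩
  suc (K + q)         ≡⟨ +-suc K q ⟨
  K + suc q           ∎
  where
  open ≤-Reasoning
  a+r≤t : a + r ≤ t
  a+r≤t = begin
    a + r               ≡⟨ +-comm a r ⟩
    r + a               ≤⟨ +-monoʳ-≤ r (m≤m+n a (q * a)) ⟩
    r + suc q * a       ≡⟨ t≡ ⟨
    t                   ∎

representable⇔apéry≤ : ∀ {a k r} .{{_ : NonZero a}} → 7 ≤ a → r < a →
                       Representable (gens a) (k * a + r) ⇔ apéry a r ≤ k
representable⇔apéry≤ {a} {k} {r} 7≤a r<a = mk⇔ to from
  where
  to : Representable (gens a) (k * a + r) → apéry a r ≤ k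
  to rep with K , j , t , eq , j≤K , cs ← representable⁻ a rep =
    subst (apéry a r ≤_) (sym k≡) (apéry-least ¬g t≤ (t / a) t≡)
    where
    ¬g : ¬ Gap456 t
    ¬g = proj₁ (consecutiveSum456⇒ cs)
    t≤ : t ≤ K * 6
    t≤ = ≤-trans (≤⌈/6⌉*6 t) (*-monoˡ-≤ 6 (≤-trans (proj₂ (consecutiveSum456⇒ cs)) j≤K))
    k≡ : k ≡ K + t / a
    k≡ = begin
      k                   ≡⟨ +-identityʳ k ⟨
      k + 0               ≡⟨ cong (k +_) (m<n⇒m/n≡0 r<a) ⟨
      k + r / a           ≡⟨ [k*a+t]/a≡k+t/a k r ⟨
      (k * a + r) / a     ≡⟨ cong (_/ a) eq ⟩
      (K * a + t) / a     ≡⟨ [k*a+t]/a≡k+t/a K t ⟩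
      K + t / a           ∎
      where open ≡-Reasoning
    t≡ : t ≡ r + t / a * a
    t≡ = begin
      t                   ≡⟨ m≡m%n+[m/n]*n t a ⟩
      t % a + t / a * a   ≡⟨ cong (_+ t / a * a) t%a≡r ⟩
      r + t / a * a       ∎
      where
      open ≡-Reasoning
      t%a≡r : t % a ≡ r
      t%a≡r = begin
        t % a             ≡⟨ [k*a+t]%a≡t%a K t ⟨
        (K * a + t) % a   ≡⟨ cong (_% a) eq ⟨
        (k * a + r) % a   ≡⟨ [k*a+t]%a≡t%a k r ⟩
        r % a             ≡⟨ m<n⇒m%n≡m r<a ⟩
        r                 ∎
  from : ∀ {k} → apéry a r ≤ k → Representable (gens a) (k * a + r)
  from h with gap456? r
  from h              | no ¬g = representable⁺ a h (consecutiveSum456-⌈/6⌉ ¬g)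
  from {suc k} (s≤s h) | yes g =
    subst (Representable (gens a)) (fold k a r) (representable⁺ a h (consecutiveSum456-⌈/6⌉ ¬g′))
    where
    ¬g′ : ¬ Gap456 (a + r)
    ¬g′ g′ = <⇒≱ (Gap456⇒<8 g′) (+-mono-≤ 7≤a (Gap456⇒>0 g))
    fold : ∀ k a r → k * a + (a + r) ≡ suc k * a + r
    fold = solve-∀

-- Summing the gaps

classSum : ℕ → ℕ → ℕ → ℕ
classSum a r K = ∑ K (λ k → k * a + r)

twiceClassSum : ℕ → ℕ → ℕ → ℕ
twiceClassSum a r K = suc K * (2 * r) + a * (K * suc K)

twice-classSum : ∀ a r K → 2 * classSum a r (suc K) ≡ twiceClassSum a r K
twice-classSum a r zero = base a r
  where
  base : ∀ a r → 2 * (r + 0) ≡ 1 * (2 * r) + a * (0 * 1)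
  base = solve-∀
twice-classSum a r (suc K) = begin
  2 * classSum a r (suc (suc K))                      ≡⟨ cong (2 *_) (∑-suc (suc K) (λ k → k * a + r)) ⟩
  2 * (classSum a r (suc K) + (suc K * a + r))        ≡⟨ *-distribˡ-+ 2 (classSum a r (suc K)) (suc K * a + r) ⟩
  2 * classSum a r (suc K) + 2 * (suc K * a + r)      ≡⟨ cong (_+ 2 * (suc K * a + r)) (twice-classSum a r K) ⟩
  twiceClassSum a r K + 2 * (suc K * a + r)           ≡⟨ step a r K ⟩
  twiceClassSum a r (suc K)                           ∎
  where
  open ≡-Reasoning
  step : ∀ a r K → suc K * (2 * r) + a * (K * suc K) + 2 * (suc K * a + r)
                 ≡ suc (suc K) * (2 * r) + a * (suc K * suc (suc K))
  step = solve-∀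

sylvesterSum : ℕ → ℕ
sylvesterSum a = ∑ a λ r → classSum a r (apéry a r)

-- the class sum of a residue r with apéry a r = ⌈ r /6⌉, i.e. r not a gap of ⟨4, 5, 6⟩
regularClassSum : ℕ → ℕ → ℕ
regularClassSum a r = classSum a r ⌈ r /6⌉

⌈7+t/6⌉≡2 : ∀ {t} → t < 6 → ⌈ 7 + t /6⌉ ≡ 2
⌈7+t/6⌉≡2 {0} _ = refl
⌈7+t/6⌉≡2 {1} _ = refl
⌈7+t/6⌉≡2 {2} _ = refl
⌈7+t/6⌉≡2 {3} _ = refl
⌈7+t/6⌉≡2 {4} _ = refl
⌈7+t/6⌉≡2 {5} _ = refl
⌈7+t/6⌉≡2 {suc (suc (suc (suc (suc (suc t)))))} t<6 = contradiction t<6 (≤⇒≯ (m≤m+n 6 t))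

⌈7+[m*6+t]/6⌉≡2+m : ∀ m {t} → t < 6 → ⌈ 7 + (m * 6 + t) /6⌉ ≡ 2 + m
⌈7+[m*6+t]/6⌉≡2+m m {t} t<6 = begin
  ⌈ 7 + (m * 6 + t) /6⌉   ≡⟨ cong ⌈_/6⌉ (regroup m t) ⟩
  ⌈ 7 + t + m * 6 /6⌉     ≡⟨ ⌈+*6/6⌉ (7 + t) m ⟩
  ⌈ 7 + t /6⌉ + m         ≡⟨ cong (_+ m) (⌈7+t/6⌉≡2 t<6) ⟩
  2 + m                   ∎
  where
  open ≡-Reasoning
  regroup : ∀ m t → 7 + (m * 6 + t) ≡ 7 + t + m * 6
  regroup = solve-∀

fullPeriodsPoly : ℕ → ℕ → ℕ
fullPeriodsPoly a m = 24 * (m * m * m) + 93 * (m * m) + 111 * m + 2 * a * (m * (1 + m) * (2 + m))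

partialPeriodPoly : ℕ → ℕ → ℕ → ℕ
partialPeriodPoly a m c = (2 + m) * c * (13 + 12 * m + c) + c * a * ((1 + m) * (2 + m))

twice-partialPeriod : ∀ a m c → c ≤ 6 →
  2 * ∑ c (λ t → regularClassSum a (7 + (m * 6 + t))) ≡ partialPeriodPoly a m c
twice-partialPeriod a m zero    _ = empty a m
  where
  empty : ∀ a m → 0 ≡ (2 + m) * 0 * (13 + 12 * m + 0) + 0 * a * ((1 + m) * (2 + m))
  empty = solve-∀
twice-partialPeriod a m (suc c) c<6 = begin
  2 * ∑ (suc c) F                       ≡⟨ cong (2 *_) (∑-suc c F) ⟩
  2 * (∑ c F + F c)                     ≡⟨ *-distribˡ-+ 2 (∑ c F) (F c) ⟩
  2 * ∑ c F + 2 * F c                   ≡⟨ cong₂ _+_ (twice-partialPeriod a m c (<⇒≤ c<6)) twice-Fc ⟩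
  partialPeriodPoly a m c + ((2 + m) * (2 * (7 + (m * 6 + c))) + a * ((1 + m) * (2 + m)))
                                        ≡⟨ step a m c ⟩
  partialPeriodPoly a m (suc c)          ∎
  where
  open ≡-Reasoning
  F : ℕ → ℕ
  F t = regularClassSum a (7 + (m * 6 + t))
  twice-Fc : 2 * F c ≡ twiceClassSum a (7 + (m * 6 + c)) (suc m)
  twice-Fc = trans (cong (λ K → 2 * classSum a (7 + (m * 6 + c)) K) (⌈7+[m*6+t]/6⌉≡2+m m c<6))
                   (twice-classSum a (7 + (m * 6 + c)) (suc m))
  step : ∀ a m c → (2 + m) * c * (13 + 12 * m + c) + c * a * ((1 + m) * (2 + m))
                     + ((2 + m) * (2 * (7 + (m * 6 + c))) + a * ((1 + m) * (2 + m)))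
                   ≡ (2 + m) * suc c * (13 + 12 * m + suc c) + suc c * a * ((1 + m) * (2 + m))
  step = solve-∀

twice-fullPeriods : ∀ a m →
  2 * ∑ (m * 6) (λ i → regularClassSum a (7 + i)) ≡ fullPeriodsPoly a m
twice-fullPeriods a zero = empty a
  where
  empty : ∀ a → 0 ≡ 24 * (0 * 0 * 0) + 93 * (0 * 0) + 111 * 0 + 2 * a * (0 * (1 + 0) * (2 + 0))
  empty = solve-∀
twice-fullPeriods a (suc m) = begin
  2 * ∑ (suc m * 6) G                          ≡⟨ cong (λ n → 2 * ∑ n G) (+-comm 6 (m * 6)) ⟩
  2 * ∑ (m * 6 + 6) G                          ≡⟨ cong (2 *_) (∑-+ (m * 6) 6 G) ⟩
  2 * (∑ (m * 6) G + ∑ 6 (λ t → G (m * 6 + t))) ≡⟨ *-distribˡ-+ 2 (∑ (m * 6) G) _ ⟩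
  2 * ∑ (m * 6) G + 2 * ∑ 6 (λ t → G (m * 6 + t))
    ≡⟨ cong₂ _+_ (twice-fullPeriods a m) (twice-partialPeriod a m 6 ≤-refl) ⟩
  fullPeriodsPoly a m + partialPeriodPoly a m 6 ≡⟨ step a m ⟩
  fullPeriodsPoly a (suc m)                     ∎
  where
  open ≡-Reasoning
  G : ℕ → ℕ
  G i = regularClassSum a (7 + i)
  step : ∀ a m → 24 * (m * m * m) + 93 * (m * m) + 111 * m + 2 * a * (m * (1 + m) * (2 + m))
                   + ((2 + m) * 6 * (13 + 12 * m + 6) + 6 * a * ((1 + m) * (2 + m)))
                 ≡ 24 * (suc m * suc m * suc m) + 93 * (suc m * suc m) + 111 * suc m
                   + 2 * a * (suc m * (1 + suc m) * (2 + suc m))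
  step = solve-∀

twice-regularSum : ∀ a m c → c ≤ 6 →
  2 * ∑ (m * 6 + c) (λ i → regularClassSum a (7 + i)) ≡ fullPeriodsPoly a m + partialPeriodPoly a m c
twice-regularSum a m c c≤6 = begin
  2 * ∑ (m * 6 + c) G                              ≡⟨ cong (2 *_) (∑-+ (m * 6) c G) ⟩
  2 * (∑ (m * 6) G + ∑ c (λ t → G (m * 6 + t)))    ≡⟨ *-distribˡ-+ 2 (∑ (m * 6) G) _ ⟩
  2 * ∑ (m * 6) G + 2 * ∑ c (λ t → G (m * 6 + t))  ≡⟨ cong₂ _+_ (twice-fullPeriods a m) (twice-partialPeriod a m c c≤6) ⟩
  fullPeriodsPoly a m + partialPeriodPoly a m c    ∎
  where
  open ≡-Reasoning
  G : ℕ → ℕ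
  G i = regularClassSum a (7 + i)

-- The gap 7 is also counted as a regular class (compensated on the left), so that
-- the regular classes come in whole periods 7 + 6m, …, 7 + 6m + 5.
sylvesterSum-split : ∀ j → let a = 8 + j in
  sylvesterSum a + regularClassSum a 7
    ≡ classSum a 1 (apéry a 1) + classSum a 2 (apéry a 2) + classSum a 3 (apéry a 3)
      + classSum a 7 (apéry a 7) + 15 + ∑ (suc j) (λ i → regularClassSum a (7 + i))
sylvesterSum-split j =
  regroup (classSum a 1 (apéry a 1)) (classSum a 2 (apéry a 2)) (classSum a 3 (apéry a 3))
          (classSum a 7 (apéry a 7)) (regularClassSum a 7) (∑ j λ i → regularClassSum a (8 + i))
  where
  a : ℕ
  a = 8 + j
  regroup : ∀ g₁ g₂ g₃ g₇ u R → g₁ + (g₂ + (g₃ + (4 + (5 + (6 + (g₇ + R)))))) + u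
                              ≡ g₁ + g₂ + g₃ + g₇ + 15 + (u + R)
  regroup = solve-∀

twice-gapClassSum : ∀ j m c r → suc j ≡ m * 6 + c →
  2 * classSum (8 + j) r (suc ⌈ 8 + j + r /6⌉) ≡ twiceClassSum (8 + j) r (⌈ 7 + c + r /6⌉ + m)
twice-gapClassSum j m c r e =
  trans (twice-classSum (8 + j) r ⌈ 8 + j + r /6⌉) (cong (twiceClassSum (8 + j) r) ⌈a+r/6⌉≡)
  where
  regroup : ∀ m c r → 7 + (m * 6 + c) + r ≡ 7 + c + r + m * 6
  regroup = solve-∀
  ⌈a+r/6⌉≡ : ⌈ 8 + j + r /6⌉ ≡ ⌈ 7 + c + r /6⌉ + m
  ⌈a+r/6⌉≡ = trans (cong (λ n → ⌈ 7 + n + r /6⌉) e)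
                   (trans (cong ⌈_/6⌉ (regroup m c r)) (⌈+*6/6⌉ (7 + c + r) m))

closedForm : (a m c K₁ K₂ K₃ K₇ : ℕ) → ℕ
closedForm a m c K₁ K₂ K₃ K₇ =
  twiceClassSum a 1 K₁ + twiceClassSum a 2 K₂ + twiceClassSum a 3 K₃ + twiceClassSum a 7 K₇ + 30
  + (fullPeriodsPoly a m + partialPeriodPoly a m c)

twice-sylvesterSum : ∀ j m c → suc j ≡ m * 6 + c → c ≤ 6 →
  2 * sylvesterSum (8 + j) + twiceClassSum (8 + j) 7 1
    ≡ closedForm (8 + j) m c (⌈ 7 + c + 1 /6⌉ + m) (⌈ 7 + c + 2 /6⌉ + m)
                             (⌈ 7 + c + 3 /6⌉ + m) (⌈ 7 + c + 7 /6⌉ + m)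
twice-sylvesterSum j m c e c≤6 = begin
  2 * sylvesterSum a + twiceClassSum a 7 1            ≡⟨ cong (2 * sylvesterSum a +_) (twice-classSum a 7 1) ⟨
  2 * sylvesterSum a + 2 * regularClassSum a 7        ≡⟨ *-distribˡ-+ 2 (sylvesterSum a) _ ⟨
  2 * (sylvesterSum a + regularClassSum a 7)          ≡⟨ cong (2 *_) (sylvesterSum-split j) ⟩
  2 * (g 1 + g 2 + g 3 + g 7 + 15 + R)                ≡⟨ distrib (g 1) (g 2) (g 3) (g 7) R ⟩
  2 * g 1 + 2 * g 2 + 2 * g 3 + 2 * g 7 + 30 + 2 * R
    ≡⟨ cong₂ _+_ (cong (_+ 30) (cong₂ _+_ (cong₂ _+_ (cong₂ _+_ (gap 1) (gap 2)) (gap 3)) (gap 7)))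
                 (trans (cong (λ n → 2 * ∑ n (λ i → regularClassSum a (7 + i))) e)
                        (twice-regularSum a m c c≤6)) ⟩
  closedForm a m c (⌈ 7 + c + 1 /6⌉ + m) (⌈ 7 + c + 2 /6⌉ + m) (⌈ 7 + c + 3 /6⌉ + m) (⌈ 7 + c + 7 /6⌉ + m) ∎
  where
  open ≡-Reasoning
  a : ℕ
  a = 8 + j
  g : ℕ → ℕ
  g r = classSum a r (suc ⌈ a + r /6⌉)
  R : ℕ
  R = ∑ (suc j) (λ i → regularClassSum a (7 + i))
  gap : ∀ r → 2 * g r ≡ twiceClassSum a r (⌈ 7 + c + r /6⌉ + m)
  gap r = twice-gapClassSum j m c r e
  distrib : ∀ g₁ g₂ g₃ g₇ R → 2 * (g₁ + g₂ + g₃ + g₇ + 15 + R) ≡ 2 * g₁ + 2 * g₂ + 2 * g₃ + 2 * g₇ + 30 + 2 * R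
  distrib = solve-∀

-- indexed by a % 6; the last clause is the residue 5
sylvesterPoly : ℕ → ℕ → ℕ
sylvesterPoly 0 a = a ^ 4 + 21 * a ^ 3 + 261 * a ^ 2 + 1494 * a + 2808
sylvesterPoly 1 a = a ^ 4 + 21 * a ^ 3 + 222 * a ^ 2 + 1199 * a + 2445
sylvesterPoly 2 a = a ^ 4 + 21 * a ^ 3 + 213 * a ^ 2 + 1078 * a + 1992
sylvesterPoly 3 a = (a + 3) * (a ^ 3 + 18 * a ^ 2 + 144 * a + 495)
sylvesterPoly 4 a = a ^ 4 + 21 * a ^ 3 + 213 * a ^ 2 + 1046 * a + 1608
sylvesterPoly _ a = a ^ 4 + 21 * a ^ 3 + 222 * a ^ 2 + 1087 * a + 1533

-- closedForm and the quartic a⁴ + 21a³ + αa² + βa + γ for a = 7 + 6m + c, with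
-- apéry a r = vᵣ + m + 1 for the gaps r; spelled out because the ring solver does
-- not unfold definitions.
QuarticIdentity : (c α β γ v₁ v₂ v₃ v₇ : ℕ) → Set
QuarticIdentity c α β γ v₁ v₂ v₃ v₇ = ∀ m →
  let a = 7 + (m * 6 + c)
      T : ℕ → ℕ → ℕ
      T r K = suc K * (2 * r) + a * (K * suc K)
  in  a * (a * (a * (a * 1))) + 21 * (a * (a * (a * 1))) + α * (a * (a * 1)) + β * a + γ + 108 * T 7 1
    ≡ 108 * (T 1 (v₁ + m) + T 2 (v₂ + m) + T 3 (v₃ + m) + T 7 (v₇ + m) + 30
             + (24 * (m * m * m) + 93 * (m * m) + 111 * m + 2 * a * (m * (1 + m) * (2 + m))
                + ((2 + m) * c * (13 + 12 * m + c) + c * a * ((1 + m) * (2 + m)))))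

residue-identity : ∀ c → c < 6 → ∀ m → let a = 7 + (m * 6 + c) in
  sylvesterPoly ((7 + c) % 6) a + 108 * twiceClassSum a 7 1
    ≡ 108 * closedForm a m c (⌈ 7 + c + 1 /6⌉ + m) (⌈ 7 + c + 2 /6⌉ + m)
                             (⌈ 7 + c + 3 /6⌉ + m) (⌈ 7 + c + 7 /6⌉ + m)
residue-identity 0 _ = identity
  where identity : QuarticIdentity 0 222 1199 2445 2 2 2 3
        identity = solve-∀
residue-identity 1 _ = identity
  where identity : QuarticIdentity 1 213 1078 1992 2 2 2 3
        identity = solve-∀
residue-identity 2 _ m =
  trans (cong (_+ 108 * twiceClassSum a 7 1) (expand a)) (identity m)
  where a : ℕ
        a = 7 + (m * 6 + 2)
        identity : QuarticIdentity 2 198 927 1485 2 2 2 3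
        identity = solve-∀
        expand : ∀ a → (a + 3) * (a * (a * (a * 1)) + 18 * (a * (a * 1)) + 144 * a + 495)
                     ≡ a * (a * (a * (a * 1))) + 21 * (a * (a * (a * 1))) + 198 * (a * (a * 1)) + 927 * a + 1485
        expand = solve-∀
residue-identity 3 _ = identity
  where identity : QuarticIdentity 3 213 1046 1608 2 2 3 3
        identity = solve-∀
residue-identity 4 _ = identity
  where identity : QuarticIdentity 4 222 1087 1533 2 3 3 3
        identity = solve-∀
residue-identity 5 _ = identity
  where identity : QuarticIdentity 5 261 1494 2808 3 3 3 4
        identity = solve-∀
residue-identity (suc (suc (suc (suc (suc (suc c)))))) c<6 _ = contradiction c<6 (≤⇒≯ (m≤m+n 6 c))

sylvesterSum-formula : ∀ j → 216 * sylvesterSum (8 + j) ≡ sylvesterPoly ((8 + j) % 6) (8 + j)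
sylvesterSum-formula j = begin
  216 * sylvesterSum a                    ≡⟨ cancel (sylvesterSum a) (twice-sylvesterSum j m c e (<⇒≤ c<6)) identity ⟩
  sylvesterPoly ((7 + c) % 6) a           ≡⟨ cong (λ d → sylvesterPoly d a) a%6 ⟨
  sylvesterPoly (a % 6) a                 ∎
  where
  open ≡-Reasoning
  a : ℕ
  a = 8 + j
  m c : ℕ
  m = suc j / 6
  c = suc j % 6
  c<6 : c < 6
  c<6 = m%n<n (suc j) 6
  e : suc j ≡ m * 6 + c
  e = trans (m≡m%n+[m/n]*n (suc j) 6) (+-comm c (m * 6))
  regroup : ∀ m c → 7 + (m * 6 + c) ≡ 7 + c + m * 6
  regroup = solve-∀
  a%6 : a % 6 ≡ (7 + c) % 6
  a%6 = trans (cong (λ n → (7 + n) % 6) e) (trans (cong (_% 6) (regroup m c)) ([m+kn]%n≡m%n (7 + c) m 6))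
  identity : sylvesterPoly ((7 + c) % 6) a + 108 * twiceClassSum a 7 1
           ≡ 108 * closedForm a m c (⌈ 7 + c + 1 /6⌉ + m) (⌈ 7 + c + 2 /6⌉ + m)
                                    (⌈ 7 + c + 3 /6⌉ + m) (⌈ 7 + c + 7 /6⌉ + m)
  identity = subst (λ b → sylvesterPoly ((7 + c) % 6) b + 108 * twiceClassSum b 7 1
                        ≡ 108 * closedForm b m c (⌈ 7 + c + 1 /6⌉ + m) (⌈ 7 + c + 2 /6⌉ + m)
                                                 (⌈ 7 + c + 3 /6⌉ + m) (⌈ 7 + c + 7 /6⌉ + m))
                   (cong (7 +_) (sym e)) (residue-identity c c<6 m)
  cancel : ∀ s {t C P} → 2 * s + t ≡ C → P + 108 * t ≡ 108 * C → 216 * s ≡ P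
  cancel s {t} {C} {P} twice poly = +-cancelʳ-≡ (108 * t) (216 * s) P (begin
    216 * s + 108 * t     ≡⟨ scale s t ⟩
    108 * (2 * s + t)     ≡⟨ cong (108 *_) twice ⟩
    108 * C               ≡⟨ poly ⟨
    P + 108 * t           ∎)
    where scale : ∀ s t → 216 * s + 108 * t ≡ 108 * (2 * s + t)
          scale = solve-∀

corollary7 : ∀ (a : ℕ) → 8 ≤ a →
    ∃ λ (s : ℕ) → IsSylvesterSum (a ∷ a + 4 ∷ a + 5 ∷ a + 6 ∷ []) s
      × (a % 6 ≡ 0 → 216 * s ≡ a ^ 4 + 21 * a ^ 3 + 261 * a ^ 2 + 1494 * a + 2808)
      × (a % 6 ≡ 1 → 216 * s ≡ a ^ 4 + 21 * a ^ 3 + 222 * a ^ 2 + 1199 * a + 2445)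
      × (a % 6 ≡ 2 → 216 * s ≡ a ^ 4 + 21 * a ^ 3 + 213 * a ^ 2 + 1078 * a + 1992)
      × (a % 6 ≡ 3 → 216 * s ≡ (a + 3) * (a ^ 3 + 18 * a ^ 2 + 144 * a + 495))
      × (a % 6 ≡ 4 → 216 * s ≡ a ^ 4 + 21 * a ^ 3 + 213 * a ^ 2 + 1046 * a + 1608)
      × (a % 6 ≡ 5 → 216 * s ≡ a ^ 4 + 21 * a ^ 3 + 222 * a ^ 2 + 1087 * a + 1533)
corollary7 a 8≤a with j , refl ← m≤n⇒∃[o]m+o≡n 8≤a =
  sylvesterSum a , isSylvesterSum , formula , formula , formula , formula , formula , formula
  where
  open ApéryQuotients (gens a) a (apéry a) (λ k r → representable⇔apéry≤ (m≤m+n 7 (suc j)))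
  formula : ∀ {d} → a % 6 ≡ d → 216 * sylvesterSum a ≡ sylvesterPoly d a
  formula a%6≡d = trans (sylvesterSum-formula j) (cong (λ d → sylvesterPoly d a) a%6≡d)
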